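{- Let $R$ be a finite poset on ground set $[n]$ and $\phi:R\to R$ an automorphism. Let $e=(e_1,e_2)$ and $f=(f_1,f_2)$ be two pairs of incomparable elements of $R$ such that in $R+(f_2\prec f_1)$ both $e_1\prec e_2$ and $\phi^{ -1}(e_1)\prec\phi^{ -1}(e_2)$ hold. Let $m>0$ be the smallest positive integer with $\phi^{m+1}(e)=e$ (where $\phi(e)=(\phi(e_1),\phi(e_2))$). Set $$P=R+(f_1\prec f_2)+(e_1\prec e_2)+(\phi(e_1)\prec\phi(e_2))+\cdots+(\phi^{m-1}(e_1)\prec\phi^{m-1}(e_2)),$$ $$Q=R+(f_1\prec f_2)+(\phi(e_1)\prec\phi(e_2))+(\phi^{2}(e_1)\prec\phi^{2}(e_2))+\cdots+(\phi^{m}(e_1)\prec\phi^{m}(e_2)).$$ If $P$ and $Q$ are both naturally labeled, then $K_P(\mathbf{x})=K_Q(\mathbf{x})$.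
   Context: For a poset $P$ and incomparable elements $x,y$, $P+(x\prec y)$ denotes the poset obtained by adding the relation $x\prec y$ and taking the transitive closure; iterated additions are performed successively (it is implicitly assumed the resulting relations define posets). A poset $(P,\preceq)$ on ground set $[n]$ is naturally labeled if $x\preceq y$ implies $x\le y$ as integers. For such $P$, $K_P(\mathbf{x})=\sum_{\sigma}\prod_{p\in P}x_{\sigma(p)}$, the sum over all maps $\sigma:P\to\mathbb{Z}^+$ with $\sigma(x)\le\sigma(y)$ whenever $x\preceq y$. -}

module Defs where

open import Data.Bool using (Bool; true; false; _∧_; _∨_; not)
open import Data.Nat using (ℕ; zero; suc; _≤_; _≤ᵇ_; _≡ᵇ_)
open import Data.Fin using (Fin; toℕ; _≟_)
open import Data.Fin.Permutation using (Permutation′; _⟨$⟩ʳ_; _⟨$⟩ˡ_)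
open import Data.List using (List; []; _∷_; [_]; map; concatMap; filter; filterᵇ; length; allFin; lookup)
open import Data.Bool.ListAction using (and)
open import Data.Product using (_×_; _,_)
open import Relation.Nullary.Decidable using (does)
open import Relation.Binary.PropositionalEquality using (_≡_)

-- A (reflexive) order relation on the ground set [n] = Fin n, as a Boolean matrix:
-- R a b ≡ true  means  a ⪯ b.
BRel : ℕ → Set
BRel n = Fin n → Fin n → Bool

IsPosetRel : ∀ {n} → BRel n → Set
IsPosetRel {n} R =
  (∀ a → R a a ≡ true) ×
  (∀ a b → R a b ≡ true → R b a ≡ true → a ≡ b) ×
  (∀ a b c → R a b ≡ true → R b c ≡ true → R a c ≡ true)

Incomparable : ∀ {n} → BRel n → Fin n → Fin n → Set
Incomparable R x y = (R x y ≡ false) × (R y x ≡ false)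

-- P + (x ≺ y): add the relation x ≺ y and take the transitive closure.
-- For a reflexive transitive R the closure is exactly:
--   a ⪯' b  iff  a ⪯ b  or  (a ⪯ x and y ⪯ b).
addRel : ∀ {n} → BRel n → Fin n → Fin n → BRel n
addRel R x y a b = R a b ∨ (R a x ∧ R y b)

addRels : ∀ {n} → BRel n → List (Fin n × Fin n) → BRel n
addRels R [] = R
addRels R ((x , y) ∷ ps) = addRels (addRel R x y) ps

NaturallyLabeled : ∀ {n} → BRel n → Set
NaturallyLabeled R = ∀ a b → R a b ≡ true → toℕ a ≤ toℕ b

IsAutomorphism : ∀ {n} → BRel n → Permutation′ n → Set
IsAutomorphism R φ = ∀ a b → R (φ ⟨$⟩ʳ a) (φ ⟨$⟩ʳ b) ≡ R a b

iter : ∀ {A : Set} → ℕ → (A → A) → A → A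
iter zero    f x = x
iter (suc k) f x = f (iter k f x)

orbitPairs : ∀ {n} → Permutation′ n → Fin n → Fin n → ℕ → ℕ → List (Fin n × Fin n)
orbitPairs φ e₁ e₂ lo zero = []
orbitPairs φ e₁ e₂ lo (suc len) =
  (iter lo (φ ⟨$⟩ʳ_) e₁ , iter lo (φ ⟨$⟩ʳ_) e₂) ∷ orbitPairs φ e₁ e₂ (suc lo) len

consF : ∀ {n k} → Fin k → (Fin n → Fin k) → Fin (suc n) → Fin k
consF j σ Fin.zero    = j
consF j σ (Fin.suc i) = σ i

allMaps : (n k : ℕ) → List (Fin n → Fin k)
allMaps zero    k = [ (λ ()) ]
allMaps (suc n) k = concatMap (λ σ → map (λ j → consF j σ) (allFin k)) (allMaps n k)

-- σ is order preserving (a P-partition with values in {1,...,k}; value j+1 ↔ index j).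
orderPres : ∀ {n k} → BRel n → (Fin n → Fin k) → Bool
orderPres {n} R σ =
  and (concatMap (λ a → map (λ b → not (R a b) ∨ (toℕ (σ a) ≤ᵇ toℕ (σ b))) (allFin n)) (allFin n))

fiberSize : ∀ {n k} → (Fin n → Fin k) → Fin k → ℕ
fiberSize {n} σ j = length (filter (λ a → σ a ≟ j) (allFin n))

hasContent : ∀ {n} (c : List ℕ) → (Fin n → Fin (length c)) → Bool
hasContent c σ = and (map (λ j → fiberSize σ j ≡ᵇ lookup c j) (allFin (length c)))

-- K_R(x) as a formal power series: K R c is the coefficient of the monomial
-- x₁^{c₁} x₂^{c₂} ⋯ x_k^{c_k} (c = c₁ ∷ ⋯ ∷ c_k) in
--   K_R(x) = Σ_{σ : R → ℤ⁺ order preserving} ∏_{p} x_{σ(p)}.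
-- (Every monomial is of this form; only σ with values ≤ k contribute.)
K : ∀ {n} → BRel n → List ℕ → ℕ
K {n} R c = length (filterᵇ (λ σ → orderPres R σ ∧ hasContent c σ) (allMaps n (length c)))

module Submission where

-- Let S = R + (f₁ ≺ f₂), let Λ = e, φ(e), …, φ^{m-1}(e) and
-- Λ' = φ(e), …, φ^m(e), so that P = S + Λ and Q = S + Λ'.  Put P₀ = R + Λ and
-- Q₀ = R + Λ'.
--   * Splitting the order-preserving maps of P₀ according to whether
--     σ(f₁) ≤ σ(f₂) gives K_{P₀} = K_P + N_Λ, where N_Λ counts the
--     P₀-partitions with σ(f₂) < σ(f₁); likewise K_{Q₀} = K_Q + N_{Λ'}.
--   * A map with σ(f₂) < σ(f₁) is order preserving for R + (f₂ ≺ f₁), which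
--     already forces e₁ ≺ e₂ and φ⁻¹(e₁) ≺ φ⁻¹(e₂) = φ^m(e₁) ≺ φ^m(e₂).  So these
--     two pairs may be dropped: N_Λ = N_M = N_{Λ'} with M = φ(e), …, φ^{m-1}(e).
--   * φ is an isomorphism from P₀ onto Q₀, and K is invariant under relabelling.

open import Defs
open import Level using (Level)
open import Algebra.Bundles using (CommutativeMonoid)
open import Data.Bool using (Bool; true; false; _∧_; _∨_; not; T; T?)
open import Data.Bool.Properties
  using (∧-conicalˡ; ∧-conicalʳ; ∨-zeroʳ; ∧-assoc; ∧-identityʳ; ∧-zeroʳ; ∧-commutativeMonoid; T-≡; ⇔→≡)
open import Data.Bool.ListAction using (and; all)
open import Data.Nat using (ℕ; zero; suc; _+_; _<_; _≤_; _≤ᵇ_; _≡ᵇ_)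
open import Data.Nat.Properties using (≤-antisym; ≤-trans; ≰⇒≥; ≤ᵇ⇒≤; ≤⇒≤ᵇ; +-suc; +-identityʳ; +-cancelʳ-≡)
open import Data.Fin using (Fin; toℕ; _≟_)
open import Data.Fin.Permutation using (Permutation′; _⟨$⟩ʳ_; _⟨$⟩ˡ_; inverseˡ; inverseʳ)
open import Data.List
  using (List; []; _∷_; [_]; _++_; length; map; filter; filterᵇ; concatMap; cartesianProductWith; allFin; lookup)
open import Data.List.Properties using (length-map; map-cong; filter-≐; ++-identityʳ)
open import Data.List.Relation.Unary.Any using (here; there)
open import Data.List.Relation.Unary.All as All using (All; []; _∷_)
import Data.List.Relation.Unary.All.Properties as Allₚ
import Data.List.Relation.Unary.AllPairs as AllPairs
open import Data.List.Membership.Propositional.Properties using (∈-allFin)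
import Data.List.Membership.Setoid as SetoidMembership
import Data.List.Membership.Setoid.Properties as SetoidMembershipₚ
import Data.List.Relation.Unary.Unique.Setoid as SetoidUnique
import Data.List.Relation.Unary.Unique.Setoid.Properties as SetoidUniqueₚ
open import Data.List.Relation.Unary.Unique.Propositional.Properties using (allFin⁺)
import Data.List.Fresh as Fresh
import Data.List.Fresh.Relation.Unary.Any as FreshAny
import Data.List.Fresh.Membership.Setoid as FreshMembership
import Data.List.Fresh.Membership.Setoid.Properties as FreshMembershipₚ
open import Data.Product using (_×_; _,_)
import Data.Product as Product
open import Function using (_∘_; id)
open import Function.Bundles using (Bijection; Equivalence; mk⇔)
open import Function.Properties.Inverse using (Inverse⇒Bijection)
open import Relation.Binary.Bundles using (Setoid)
open import Relation.Binary.Definitions using (_Respects_)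
open import Relation.Binary.PropositionalEquality
  using (_≡_; refl; sym; trans; cong; cong₂; subst; subst₂; _≗_; _→-setoid_; setoid; module ≡-Reasoning)
open import Relation.Nullary using (¬_; contradiction)
open import Relation.Unary using (Pred; Decidable)
open import Algebra.Properties.CommutativeSemigroup
  (CommutativeMonoid.commutativeSemigroup ∧-commutativeMonoid) using (xy∙z≈xz∙y)

-- Counting in a setoid: duplicate-free lists with the same members (up to ≈)
-- have the same length, so counting over a complete duplicate-free
-- enumeration is invariant under bijections.
module DuplicateFreeCounting {a ℓ : Level} (S : Setoid a ℓ) where
  open Setoid S using (_≈_; _≉_) renaming (Carrier to A; sym to ≈-sym)
  open SetoidMembership S using (_∈_)
  open SetoidUnique S using (Unique)
  open FreshMembership S using () renaming (_∈_ to _∈#_)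

  -- A duplicate-free list is a fresh list for the apartness relation _≉_,
  -- for which the library provides the pigeonhole principle.
  private
    fresh : ∀ {xs} → Unique xs → Fresh.List# A _≉_
    fresh = Fresh.fromList

    fresh-length : ∀ {xs} (u : Unique xs) → Fresh.length (fresh u) ≡ length xs
    fresh-length AllPairs.[]      = refl
    fresh-length (_ AllPairs.∷ u) = cong suc (fresh-length u)

    fresh-∈⁺ : ∀ {x xs} (u : Unique xs) → x ∈ xs → x ∈# fresh u
    fresh-∈⁺ (_ AllPairs.∷ u) (here x≈y)  = FreshAny.here x≈y
    fresh-∈⁺ (_ AllPairs.∷ u) (there x∈) = FreshAny.there (fresh-∈⁺ u x∈)

    fresh-∈⁻ : ∀ {x xs} (u : Unique xs) → x ∈# fresh u → x ∈ xs
    fresh-∈⁻ (_ AllPairs.∷ u) (FreshAny.here x≈y)  = here x≈y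
    fresh-∈⁻ (_ AllPairs.∷ u) (FreshAny.there x∈) = there (fresh-∈⁻ u x∈)

  unique-⊆⇒length-≤ : ∀ {xs ys} → Unique xs → Unique ys
    → (∀ {x} → x ∈ xs → x ∈ ys) → length xs ≤ length ys
  unique-⊆⇒length-≤ uxs uys xs⊆ys =
    subst₂ _≤_ (fresh-length uxs) (fresh-length uys)
      (FreshMembershipₚ.injection S id (fresh-∈⁺ uys ∘ xs⊆ys ∘ fresh-∈⁻ uxs))

  unique-sameMembers⇒length-≡ : ∀ {xs ys} → Unique xs → Unique ys
    → (∀ {x} → x ∈ xs → x ∈ ys) → (∀ {x} → x ∈ ys → x ∈ xs) → length xs ≡ length ys
  unique-sameMembers⇒length-≡ uxs uys xs⊆ys ys⊆xs =
    ≤-antisym (unique-⊆⇒length-≤ uxs uys xs⊆ys) (unique-⊆⇒length-≤ uys uxs ys⊆xs)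

  -- Relabelling a complete duplicate-free enumeration by a bijection h keeps
  -- the number of elements satisfying P: the h-images of the elements
  -- satisfying P ∘ h are pairwise distinct and are exactly those satisfying P.
  count-relabel : ∀ {p} {P : Pred A p} (P? : Decidable P) → P Respects _≈_
    → ∀ {xs} → Unique xs → (∀ x → x ∈ xs) → (h : Bijection S S)
    → let open Bijection h using (to) in
      length (filter (P? ∘ to) xs) ≡ length (filter P? xs)
  count-relabel P? resp {xs} uxs complete h =
    trans (sym (length-map to (filter (P? ∘ to) xs)))
      (unique-sameMembers⇒length-≡
        (SetoidUniqueₚ.map⁺ S S injective (SetoidUniqueₚ.filter⁺ S (P? ∘ to) {xs} uxs))
        (SetoidUniqueₚ.filter⁺ S P? {xs} uxs) image⊆ ⊆image)
    where
    open Bijection h using (to; injective; surjective) renaming (cong to to-cong)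

    image⊆ : ∀ {y} → y ∈ map to (filter (P? ∘ to) xs) → y ∈ filter P? xs
    image⊆ {y} y∈ =
      let _ , _ , y≈hx , Phx = SetoidMembershipₚ.∈-map∘filter⁻ S S (P? ∘ to) (resp ∘ to-cong) {to} {xs} y∈
      in SetoidMembershipₚ.∈-filter⁺ S P? resp (complete y) (resp (≈-sym y≈hx) Phx)

    ⊆image : ∀ {y} → y ∈ filter P? xs → y ∈ map to (filter (P? ∘ to) xs)
    ⊆image {y} y∈ =
      let _ , Py = SetoidMembershipₚ.∈-filter⁻ S P? resp {xs = xs} y∈
          x , onto = surjective y
          hx≈y = onto (Setoid.refl S)
      in SetoidMembershipₚ.∈-map∘filter⁺ S S (P? ∘ to) (resp ∘ to-cong) {to} {xs} to-cong
           (x , complete x , ≈-sym hx≈y , resp (≈-sym hx≈y) Py)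

Maps : ℕ → ℕ → Setoid _ _
Maps n k = Fin n →-setoid Fin k

extend : ∀ {n k} → (Fin n → Fin k) → Fin k → Fin (suc n) → Fin k
extend σ j = consF j σ

extend-cong : ∀ {n k} {σ τ : Fin n → Fin k} {i j} → σ ≗ τ → i ≡ j → extend σ i ≗ extend τ j
extend-cong σ≗τ i≡j Fin.zero    = i≡j
extend-cong σ≗τ i≡j (Fin.suc a) = σ≗τ a

extend-injective : ∀ {n k} {σ τ : Fin n → Fin k} {i j} → extend σ i ≗ extend τ j → σ ≗ τ × i ≡ j
extend-injective eq = eq ∘ Fin.suc , eq Fin.zero

extend-η : ∀ {n k} (σ : Fin (suc n) → Fin k) → extend (σ ∘ Fin.suc) (σ Fin.zero) ≗ σ
extend-η σ Fin.zero    = refl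
extend-η σ (Fin.suc a) = refl

concatMap-map : ∀ {A B C : Set} (f : A → B → C) xs ys
  → concatMap (λ x → map (f x) ys) xs ≡ cartesianProductWith f xs ys
concatMap-map f []       ys = refl
concatMap-map f (x ∷ xs) ys = cong (map (f x) ys ++_) (concatMap-map f xs ys)

allMaps-suc : ∀ n k → allMaps (suc n) k ≡ cartesianProductWith extend (allMaps n k) (allFin k)
allMaps-suc n k = concatMap-map extend (allMaps n k) (allFin k)

allMaps-complete : ∀ n k (σ : Fin n → Fin k) → SetoidMembership._∈_ (Maps n k) σ (allMaps n k)
allMaps-complete zero    k σ = here (λ ())
allMaps-complete (suc n) k σ =
  subst (SetoidMembership._∈_ (Maps (suc n) k) σ) (sym (allMaps-suc n k))
    (SetoidMembershipₚ.∈-resp-≈ (Maps (suc n) k) (extend-η σ)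
      (SetoidMembershipₚ.∈-cartesianProductWith⁺ (Maps n k) (setoid (Fin k)) (Maps (suc n) k)
        extend-cong (allMaps-complete n k (σ ∘ Fin.suc)) (∈-allFin (σ Fin.zero))))

allMaps-unique : ∀ n k → SetoidUnique.Unique (Maps n k) (allMaps n k)
allMaps-unique zero    k = [] AllPairs.∷ AllPairs.[]
allMaps-unique (suc n) k =
  subst (SetoidUnique.Unique (Maps (suc n) k)) (sym (allMaps-suc n k))
    (SetoidUniqueₚ.cartesianProductWith⁺ (Maps n k) (setoid (Fin k)) (Maps (suc n) k)
      extend extend-injective (allMaps-unique n k) (allFin⁺ k))

precompose : ∀ {n k} → Permutation′ n → Bijection (Maps n k) (Maps n k)
precompose π = record
  { to        = _∘ (π ⟨$⟩ʳ_)
  ; cong      = λ σ≗τ → σ≗τ ∘ (π ⟨$⟩ʳ_)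
  ; bijective = injective , surjective
  }
  where
  injective : ∀ {σ τ} → σ ∘ (π ⟨$⟩ʳ_) ≗ τ ∘ (π ⟨$⟩ʳ_) → σ ≗ τ
  injective {σ} {τ} eq a =
    subst (λ b → σ b ≡ τ b) (inverseʳ π) (eq (π ⟨$⟩ˡ a))
  surjective : ∀ τ → Product.∃ λ σ → ∀ {ρ} → ρ ≗ σ → ρ ∘ (π ⟨$⟩ʳ_) ≗ τ
  surjective τ = τ ∘ (π ⟨$⟩ˡ_) , λ ρ≗σ a → trans (ρ≗σ (π ⟨$⟩ʳ a)) (cong τ (inverseˡ π))

Monotone : ∀ {n k} → BRel n → (Fin n → Fin k) → Set
Monotone R σ = ∀ a b → R a b ≡ true → toℕ (σ a) ≤ toℕ (σ b)

IsReflexive : ∀ {n} → BRel n → Set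
IsReflexive R = ∀ a → R a a ≡ true

ordered : ∀ {n k} → (Fin n → Fin k) → Fin n × Fin n → Bool
ordered σ (x , y) = toℕ (σ x) ≤ᵇ toℕ (σ y)

ordered⇒≤ : ∀ {n k} {σ : Fin n → Fin k} {x y} → ordered σ (x , y) ≡ true → toℕ (σ x) ≤ toℕ (σ y)
ordered⇒≤ h = ≤ᵇ⇒≤ _ _ (Equivalence.from T-≡ h)

≤⇒ordered : ∀ {n k} {σ : Fin n → Fin k} {x y} → toℕ (σ x) ≤ toℕ (σ y) → ordered σ (x , y) ≡ true
≤⇒ordered le = Equivalence.to T-≡ (≤⇒≤ᵇ le)

unordered⇒≥ : ∀ {n k} {σ : Fin n → Fin k} {x y} → not (ordered σ (x , y)) ≡ true → toℕ (σ y) ≤ toℕ (σ x)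
unordered⇒≥ {σ = σ} {x} {y} h =
  ≰⇒≥ (λ le → contradiction (trans (sym (cong not (≤⇒ordered {σ = σ} {x} {y} le))) h) λ ())

and-true⇒All : ∀ bs → and bs ≡ true → All (_≡ true) bs
and-true⇒All []       _ = []
and-true⇒All (b ∷ bs) h = ∧-conicalˡ b _ h ∷ and-true⇒All bs (∧-conicalʳ b _ h)

All⇒and-true : ∀ {bs} → All (_≡ true) bs → and bs ≡ true
All⇒and-true []         = refl
All⇒and-true (refl ∷ ps) = All⇒and-true ps

entry⇒ : ∀ r {i j} → not r ∨ (i ≤ᵇ j) ≡ true → r ≡ true → i ≤ j
entry⇒ true h refl = ≤ᵇ⇒≤ _ _ (Equivalence.from T-≡ h)

entry⇐ : ∀ r {i j} → (r ≡ true → i ≤ j) → not r ∨ (i ≤ᵇ j) ≡ true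
entry⇐ true  h = Equivalence.to T-≡ (≤⇒≤ᵇ (h refl))
entry⇐ false h = refl

orderPres-sound : ∀ {n k} (R : BRel n) (σ : Fin n → Fin k) → orderPres R σ ≡ true → Monotone R σ
orderPres-sound {n} R σ h a b =
  entry⇒ (R a b) (All.lookup (Allₚ.map⁻ (All.lookup rows (∈-allFin a))) (∈-allFin b))
  where
  rows : All (λ a → All (_≡ true) (map (λ b → not (R a b) ∨ (toℕ (σ a) ≤ᵇ toℕ (σ b))) (allFin n))) (allFin n)
  rows = Allₚ.map⁻ (Allₚ.concat⁻ (and-true⇒All _ h))

orderPres-complete : ∀ {n k} (R : BRel n) (σ : Fin n → Fin k) → Monotone R σ → orderPres R σ ≡ true
orderPres-complete {n} R σ mono =
  All⇒and-true (Allₚ.concat⁺ (Allₚ.map⁺ {xs = allFin n} (All.tabulate λ {a} _ →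
    Allₚ.map⁺ {xs = allFin n} (All.tabulate λ {b} _ → entry⇐ (R a b) (mono a b)))))

monotone-addRel : ∀ {n k} {R : BRel n} {σ : Fin n → Fin k} {x y}
  → Monotone R σ → toℕ (σ x) ≤ toℕ (σ y) → Monotone (addRel R x y) σ
monotone-addRel {R = R} {x = x} {y} mono x≤y a b R'ab with R a b in Rab
... | true  = mono a b Rab
... | false = ≤-trans (mono a x (∧-conicalˡ _ _ R'ab)) (≤-trans x≤y (mono y b (∧-conicalʳ _ _ R'ab)))

addRel-reflexive : ∀ {n} {R : BRel n} → IsReflexive R → ∀ x y → IsReflexive (addRel R x y)
addRel-reflexive {R = R} R-refl x y a = cong (_∨ (R a x ∧ R y a)) (R-refl a)

addRel-relates : ∀ {n} {R : BRel n} → IsReflexive R → ∀ x y → addRel R x y x y ≡ true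
addRel-relates {R = R} R-refl x y =
  trans (cong (R x y ∨_) (cong₂ _∧_ (R-refl x) (R-refl y))) (∨-zeroʳ (R x y))

orderPres-addRel : ∀ {n k} {R : BRel n} → IsReflexive R → ∀ x y (σ : Fin n → Fin k)
  → orderPres (addRel R x y) σ ≡ orderPres R σ ∧ ordered σ (x , y)
orderPres-addRel {R = R} R-refl x y σ = ⇔→≡ (mk⇔ forward backward)
  where
  forward : orderPres (addRel R x y) σ ≡ true → orderPres R σ ∧ ordered σ (x , y) ≡ true
  forward h = cong₂ _∧_
    (orderPres-complete R σ (λ a b Rab → mono a b (cong (_∨ (R a x ∧ R y b)) Rab)))
    (≤⇒ordered {σ = σ} (mono x y (addRel-relates {R = R} R-refl x y)))
    where
    mono : Monotone (addRel R x y) σ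
    mono = orderPres-sound (addRel R x y) σ h
  backward : orderPres R σ ∧ ordered σ (x , y) ≡ true → orderPres (addRel R x y) σ ≡ true
  backward h = orderPres-complete (addRel R x y) σ
    (monotone-addRel (orderPres-sound R σ (∧-conicalˡ _ _ h)) (ordered⇒≤ {σ = σ} (∧-conicalʳ _ _ h)))

all-++ : ∀ {A : Set} (p : A → Bool) xs ys → all p (xs ++ ys) ≡ all p xs ∧ all p ys
all-++ p []       ys = refl
all-++ p (x ∷ xs) ys = trans (cong (p x ∧_) (all-++ p xs ys)) (sym (∧-assoc (p x) _ _))

orderPres-addRels : ∀ {n k} {R : BRel n} → IsReflexive R → ∀ L (σ : Fin n → Fin k)
  → orderPres (addRels R L) σ ≡ orderPres R σ ∧ all (ordered σ) L
orderPres-addRels R-refl []            σ = sym (∧-identityʳ _)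
orderPres-addRels {R = R} R-refl ((x , y) ∷ L) σ = begin
  orderPres (addRels (addRel R x y) L) σ
    ≡⟨ orderPres-addRels (addRel-reflexive {R = R} R-refl x y) L σ ⟩
  orderPres (addRel R x y) σ ∧ all (ordered σ) L
    ≡⟨ cong (_∧ all (ordered σ) L) (orderPres-addRel R-refl x y σ) ⟩
  (orderPres R σ ∧ ordered σ (x , y)) ∧ all (ordered σ) L
    ≡⟨ ∧-assoc (orderPres R σ) _ _ ⟩
  orderPres R σ ∧ all (ordered σ) ((x , y) ∷ L) ∎
  where open ≡-Reasoning

-- A map that is order preserving for R and has σ y < σ x is order preserving
-- for R + (y ≺ x), so it respects every pair (u , v) related there.
reversal-forces : ∀ {n k} {R : BRel n} {x y u v} → addRel R y x u v ≡ true
  → (σ : Fin n → Fin k) → orderPres R σ ∧ not (ordered σ (x , y)) ≡ true → ordered σ (u , v) ≡ true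
reversal-forces {R = R} {x} {y} {u} {v} uv σ h =
  ≤⇒ordered {σ = σ} (monotone-addRel (orderPres-sound R σ (∧-conicalˡ _ _ h))
    (unordered⇒≥ {σ = σ} (∧-conicalʳ _ _ h)) u v uv)

drop-implied : ∀ r a b m c → (r ∧ c ≡ true → b ≡ true) → (r ∧ (a ∧ (b ∧ m))) ∧ c ≡ (r ∧ (a ∧ m)) ∧ c
drop-implied false a b m c     implied = refl
drop-implied true  a b m false implied = trans (∧-zeroʳ _) (sym (∧-zeroʳ _))
drop-implied true  a b m true  implied rewrite implied refl = refl

length-filterᵇ-cong : ∀ {A : Set} {p q : A → Bool} → (∀ x → p x ≡ q x)
  → ∀ xs → length (filterᵇ p xs) ≡ length (filterᵇ q xs)
length-filterᵇ-cong {p = p} {q} p≗q xs =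
  cong length (filter-≐ (T? ∘ p) (T? ∘ q) ((λ {x} → subst T (p≗q x)) , (λ {x} → subst T (sym (p≗q x)))) xs)

length-filterᵇ-split : ∀ {A : Set} (p q : A → Bool) xs
  → length (filterᵇ p xs) ≡ length (filterᵇ (λ x → p x ∧ q x) xs) + length (filterᵇ (λ x → p x ∧ not (q x)) xs)
length-filterᵇ-split p q []       = refl
length-filterᵇ-split p q (x ∷ xs) with p x | q x
... | false | _     = length-filterᵇ-split p q xs
... | true  | true  = cong suc (length-filterᵇ-split p q xs)
... | true  | false = trans (cong suc (length-filterᵇ-split p q xs)) (sym (+-suc _ _))

countContent : ∀ {n} (c : List ℕ) → ((Fin n → Fin (length c)) → Bool) → ℕ
countContent {n} c p = length (filterᵇ (λ σ → p σ ∧ hasContent c σ) (allMaps n (length c)))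

countContent-cong : ∀ {n} (c : List ℕ) {p q : (Fin n → Fin (length c)) → Bool}
  → (∀ σ → p σ ≡ q σ) → countContent c p ≡ countContent c q
countContent-cong {n} c p≗q =
  length-filterᵇ-cong (λ σ → cong (_∧ hasContent c σ) (p≗q σ)) (allMaps n (length c))

countContent-split : ∀ {n} (c : List ℕ) (p q : (Fin n → Fin (length c)) → Bool)
  → countContent c p ≡ countContent c (λ σ → p σ ∧ q σ) + countContent c (λ σ → p σ ∧ not (q σ))
countContent-split {n} c p q = begin
  countContent c p
    ≡⟨ length-filterᵇ-split (λ σ → p σ ∧ hasContent c σ) q maps ⟩
  length (filterᵇ (λ σ → (p σ ∧ hasContent c σ) ∧ q σ) maps)
    + length (filterᵇ (λ σ → (p σ ∧ hasContent c σ) ∧ not (q σ)) maps)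
    ≡⟨ cong₂ _+_ (length-filterᵇ-cong (λ σ → xy∙z≈xz∙y (p σ) _ _) maps)
                 (length-filterᵇ-cong (λ σ → xy∙z≈xz∙y (p σ) _ _) maps) ⟩
  countContent c (λ σ → p σ ∧ q σ) + countContent c (λ σ → p σ ∧ not (q σ)) ∎
  where
  open ≡-Reasoning
  maps : List (Fin n → Fin (length c))
  maps = allMaps n (length c)

Transports : ∀ {n} → (Fin n → Fin n) → BRel n → BRel n → Set
Transports f R R' = ∀ a b → R' (f a) (f b) ≡ R a b

fiberSize-cong : ∀ {n k} {σ τ : Fin n → Fin k} → σ ≗ τ → ∀ j → fiberSize σ j ≡ fiberSize τ j
fiberSize-cong {n} {σ = σ} {τ} σ≗τ j =
  cong length (filter-≐ (λ a → σ a ≟ j) (λ a → τ a ≟ j)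
    ((λ {a} → trans (sym (σ≗τ a))) , (λ {a} → trans (σ≗τ a))) (allFin n))

hasContent-cong : ∀ {n} (c : List ℕ) {σ τ : Fin n → Fin (length c)}
  → (∀ j → fiberSize σ j ≡ fiberSize τ j) → hasContent c σ ≡ hasContent c τ
hasContent-cong c same = cong and (map-cong (λ j → cong (_≡ᵇ lookup c j) (same j)) (allFin (length c)))

fiberSize-relabel : ∀ {n k} (π : Permutation′ n) (σ : Fin n → Fin k) j
  → fiberSize (σ ∘ (π ⟨$⟩ʳ_)) j ≡ fiberSize σ j
fiberSize-relabel {n} π σ j =
  DuplicateFreeCounting.count-relabel (setoid (Fin n)) (λ a → σ a ≟ j)
    (subst (λ a → σ a ≡ j)) (allFin⁺ n) ∈-allFin (Inverse⇒Bijection π)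

orderPres-cong : ∀ {n k} (R : BRel n) {σ τ : Fin n → Fin k} → σ ≗ τ → orderPres R σ ≡ orderPres R τ
orderPres-cong R {σ} {τ} σ≗τ = ⇔→≡ (mk⇔ (transport σ≗τ) (transport (sym ∘ σ≗τ)))
  where
  transport : ∀ {σ τ} → σ ≗ τ → orderPres R σ ≡ true → orderPres R τ ≡ true
  transport {σ} {τ} σ≗τ h = orderPres-complete R τ λ a b Rab →
    subst₂ (λ i j → toℕ i ≤ toℕ j) (σ≗τ a) (σ≗τ b) (orderPres-sound R σ h a b Rab)

orderPres-relabel : ∀ {n k} (π : Permutation′ n) {R R' : BRel n} → Transports (π ⟨$⟩ʳ_) R R'
  → (σ : Fin n → Fin k) → orderPres R (σ ∘ (π ⟨$⟩ʳ_)) ≡ orderPres R' σ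
orderPres-relabel π {R} {R'} carries σ = ⇔→≡ (mk⇔ forward backward)
  where
  forward : orderPres R (σ ∘ (π ⟨$⟩ʳ_)) ≡ true → orderPres R' σ ≡ true
  forward h = orderPres-complete R' σ λ a b R'ab →
    subst₂ (λ i j → toℕ (σ i) ≤ toℕ (σ j)) (inverseʳ π) (inverseʳ π)
      (orderPres-sound R (σ ∘ (π ⟨$⟩ʳ_)) h (π ⟨$⟩ˡ a) (π ⟨$⟩ˡ b)
        (trans (sym (carries _ _)) (subst₂ (λ i j → R' i j ≡ true) (sym (inverseʳ π)) (sym (inverseʳ π)) R'ab)))
  backward : orderPres R' σ ≡ true → orderPres R (σ ∘ (π ⟨$⟩ʳ_)) ≡ true
  backward h = orderPres-complete R (σ ∘ (π ⟨$⟩ʳ_)) λ a b Rab →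
    orderPres-sound R' σ h (π ⟨$⟩ʳ a) (π ⟨$⟩ʳ b) (trans (carries a b) Rab)

K-relabel : ∀ {n} (π : Permutation′ n) {R R' : BRel n} → Transports (π ⟨$⟩ʳ_) R R'
  → ∀ c → K R c ≡ K R' c
K-relabel {n} π {R} {R'} carries c = begin
  K R c
    ≡⟨ sym (DuplicateFreeCounting.count-relabel (Maps n k) (T? ∘ p) resp
              (allMaps-unique n k) (allMaps-complete n k) (precompose π)) ⟩
  length (filterᵇ (λ σ → p (σ ∘ (π ⟨$⟩ʳ_))) (allMaps n k))
    ≡⟨ length-filterᵇ-cong (λ σ → cong₂ _∧_ (orderPres-relabel π carries σ)
                              (hasContent-cong c {σ ∘ (π ⟨$⟩ʳ_)} (fiberSize-relabel π σ))) (allMaps n k) ⟩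
  K R' c ∎
  where
  open ≡-Reasoning
  k : ℕ
  k = length c
  p : (Fin n → Fin k) → Bool
  p σ = orderPres R σ ∧ hasContent c σ
  resp : ∀ {σ τ} → σ ≗ τ → T (p σ) → T (p τ)
  resp {σ} σ≗τ = subst T (cong₂ _∧_ (orderPres-cong R σ≗τ) (hasContent-cong c {σ} (fiberSize-cong σ≗τ)))

Kreversed : ∀ {n} → BRel n → Fin n → Fin n → List ℕ → ℕ
Kreversed R x y c = countContent c (λ σ → orderPres R σ ∧ not (ordered σ (x , y)))

reversal-split : ∀ {n} (R : BRel n) → IsReflexive R → ∀ x y L c
  → K (addRels R L) c ≡ K (addRels (addRel R x y) L) c + Kreversed (addRels R L) x y c
reversal-split R R-refl x y L c =
  trans (countContent-split c (orderPres (addRels R L)) (λ σ → ordered σ (x , y)))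
    (cong (_+ Kreversed (addRels R L) x y c) (countContent-cong c addingPair))
  where
  open ≡-Reasoning
  addingPair : ∀ σ → orderPres (addRels R L) σ ∧ ordered σ (x , y) ≡ orderPres (addRels (addRel R x y) L) σ
  addingPair σ = begin
    orderPres (addRels R L) σ ∧ ordered σ (x , y)
      ≡⟨ cong (_∧ ordered σ (x , y)) (orderPres-addRels R-refl L σ) ⟩
    (orderPres R σ ∧ all (ordered σ) L) ∧ ordered σ (x , y)
      ≡⟨ xy∙z≈xz∙y (orderPres R σ) _ _ ⟩
    (orderPres R σ ∧ ordered σ (x , y)) ∧ all (ordered σ) L
      ≡⟨ cong (_∧ all (ordered σ) L) (orderPres-addRel R-refl x y σ) ⟨
    orderPres (addRel R x y) σ ∧ all (ordered σ) L
      ≡⟨ orderPres-addRels (addRel-reflexive {R = R} R-refl x y) L σ ⟨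
    orderPres (addRels (addRel R x y) L) σ ∎

-- Among the maps with σ y < σ x, a pair (u , v) related in R + (y ≺ x) is
-- respected automatically, so it may be dropped from the added pairs.
Kreversed-drop : ∀ {n} (R : BRel n) {x y u v} → IsReflexive R → addRel R y x u v ≡ true
  → ∀ L L' c → Kreversed (addRels R (L ++ (u , v) ∷ L')) x y c ≡ Kreversed (addRels R (L ++ L')) x y c
Kreversed-drop R {x} {y} {u} {v} R-refl uv L L' c = countContent-cong c λ σ → begin
  orderPres (addRels R (L ++ (u , v) ∷ L')) σ ∧ not (ordered σ (x , y))
    ≡⟨ cong (_∧ not (ordered σ (x , y))) (conjuncts σ ((u , v) ∷ L')) ⟩
  (orderPres R σ ∧ (all (ordered σ) L ∧ (ordered σ (u , v) ∧ all (ordered σ) L'))) ∧ not (ordered σ (x , y))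
    ≡⟨ drop-implied (orderPres R σ) (all (ordered σ) L) _ (all (ordered σ) L') _ (reversal-forces uv σ) ⟩
  (orderPres R σ ∧ (all (ordered σ) L ∧ all (ordered σ) L')) ∧ not (ordered σ (x , y))
    ≡⟨ cong (_∧ not (ordered σ (x , y))) (conjuncts σ L') ⟨
  orderPres (addRels R (L ++ L')) σ ∧ not (ordered σ (x , y)) ∎
  where
  open ≡-Reasoning
  conjuncts : ∀ {k} (σ : Fin _ → Fin k) L''
    → orderPres (addRels R (L ++ L'')) σ ≡ orderPres R σ ∧ (all (ordered σ) L ∧ all (ordered σ) L'')
  conjuncts σ L'' = trans (orderPres-addRels R-refl (L ++ L'') σ) (cong (orderPres R σ ∧_) (all-++ (ordered σ) L L''))

orbitPair : ∀ {n} → Permutation′ n → Fin n → Fin n → ℕ → Fin n × Fin n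
orbitPair φ e₁ e₂ k = iter k (φ ⟨$⟩ʳ_) e₁ , iter k (φ ⟨$⟩ʳ_) e₂

orbitPairs-snoc : ∀ {n} (φ : Permutation′ n) e₁ e₂ lo len
  → orbitPairs φ e₁ e₂ lo (suc len) ≡ orbitPairs φ e₁ e₂ lo len ++ [ orbitPair φ e₁ e₂ (lo + len) ]
orbitPairs-snoc φ e₁ e₂ lo zero      = cong (λ k → [ orbitPair φ e₁ e₂ k ]) (sym (+-identityʳ lo))
orbitPairs-snoc φ e₁ e₂ lo (suc len) = cong (orbitPair φ e₁ e₂ lo ∷_)
  (trans (orbitPairs-snoc φ e₁ e₂ (suc lo) len)
         (cong (λ k → orbitPairs φ e₁ e₂ (suc lo) len ++ [ orbitPair φ e₁ e₂ k ]) (sym (+-suc lo len))))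

orbitPairs-shift : ∀ {n} (φ : Permutation′ n) e₁ e₂ lo len
  → orbitPairs φ e₁ e₂ (suc lo) len ≡ map (Product.map (φ ⟨$⟩ʳ_) (φ ⟨$⟩ʳ_)) (orbitPairs φ e₁ e₂ lo len)
orbitPairs-shift φ e₁ e₂ lo zero      = refl
orbitPairs-shift φ e₁ e₂ lo (suc len) = cong (orbitPair φ e₁ e₂ (suc lo) ∷_) (orbitPairs-shift φ e₁ e₂ (suc lo) len)

addRels-transport : ∀ {n} {f : Fin n → Fin n} {R R' : BRel n} → Transports f R R'
  → ∀ L → Transports f (addRels R L) (addRels R' (map (Product.map f f) L))
addRels-transport carries []            = carries
addRels-transport carries ((x , y) ∷ L) =
  addRels-transport (λ a b → cong₂ _∨_ (carries a b) (cong₂ _∧_ (carries a x) (carries y b))) L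

iter-period : ∀ {n} (φ : Permutation′ n) x m → iter (suc m) (φ ⟨$⟩ʳ_) x ≡ x → iter m (φ ⟨$⟩ʳ_) x ≡ φ ⟨$⟩ˡ x
iter-period φ x m fixed = trans (sym (inverseˡ φ)) (cong (φ ⟨$⟩ˡ_) fixed)

lemma5p2 : (n : ℕ) (R : BRel n) → IsPosetRel R
    → (φ : Permutation′ n) → IsAutomorphism R φ
    → (e₁ e₂ f₁ f₂ : Fin n)
    → Incomparable R e₁ e₂ → Incomparable R f₁ f₂
    → IsPosetRel (addRel R f₂ f₁)
    → addRel R f₂ f₁ e₁ e₂ ≡ true
    → addRel R f₂ f₁ (φ ⟨$⟩ˡ e₁) (φ ⟨$⟩ˡ e₂) ≡ true
    → (m : ℕ) → 0 < m
    → iter (suc m) (φ ⟨$⟩ʳ_) e₁ ≡ e₁ × iter (suc m) (φ ⟨$⟩ʳ_) e₂ ≡ e₂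
    → (∀ k → 0 < k → k < m
         → ¬ (iter (suc k) (φ ⟨$⟩ʳ_) e₁ ≡ e₁ × iter (suc k) (φ ⟨$⟩ʳ_) e₂ ≡ e₂))
    → NaturallyLabeled (addRels (addRel R f₁ f₂) (orbitPairs φ e₁ e₂ 0 m))
    → NaturallyLabeled (addRels (addRel R f₁ f₂) (orbitPairs φ e₁ e₂ 1 m))
    → ∀ (c : List ℕ)
    → K (addRels (addRel R f₁ f₂) (orbitPairs φ e₁ e₂ 0 m)) c
      ≡ K (addRels (addRel R f₁ f₂) (orbitPairs φ e₁ e₂ 1 m)) c
lemma5p2 n R _ φ _ e₁ e₂ f₁ f₂ _ _ _ _ _ zero () _ _ _ _ _
lemma5p2 n R (R-refl , _) φ automorphism e₁ e₂ f₁ f₂ _ _ _ e-forced φ⁻¹e-forced (suc m) _ (period₁ , period₂) _ _ _ c =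
  +-cancelʳ-≡ (N M) (K P c) (K Q c) (begin
    K P c + N M                ≡⟨ cong (K P c +_) (Kreversed-drop R R-refl e-forced [] M c) ⟨
    K P c + N Λ                ≡⟨ reversal-split R R-refl f₁ f₂ Λ c ⟨
    K (addRels R Λ) c          ≡⟨ K-relabel φ φ-carries c ⟩
    K (addRels R Λ') c         ≡⟨ reversal-split R R-refl f₁ f₂ Λ' c ⟩
    K Q c + N Λ'               ≡⟨ cong (λ L → K Q c + N L) Λ'≡M++φ⁻¹e ⟩
    K Q c + N (M ++ [ φ⁻¹e ])  ≡⟨ cong (K Q c +_) (Kreversed-drop R R-refl φ⁻¹e-forced M [] c) ⟩
    K Q c + N (M ++ [])        ≡⟨ cong (λ L → K Q c + N L) (++-identityʳ M) ⟩
    K Q c + N M                ∎)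
  where
  open ≡-Reasoning
  -- Λ = e, …, φ^m(e);  Λ' = φ(e), …, φ^{m+1}(e);  M = φ(e), …, φ^m(e).
  Λ Λ' M : List (Fin n × Fin n)
  Λ  = orbitPairs φ e₁ e₂ 0 (suc m)
  Λ' = orbitPairs φ e₁ e₂ 1 (suc m)
  M  = orbitPairs φ e₁ e₂ 1 m
  P Q : BRel n
  P = addRels (addRel R f₁ f₂) Λ
  Q = addRels (addRel R f₁ f₂) Λ'
  N : List (Fin n × Fin n) → ℕ
  N L = Kreversed (addRels R L) f₁ f₂ c
  φ⁻¹e : Fin n × Fin n
  φ⁻¹e = φ ⟨$⟩ˡ e₁ , φ ⟨$⟩ˡ e₂
  -- The last pair of Λ' is φ^{m+1}(e) = φ⁻¹(e).
  Λ'≡M++φ⁻¹e : Λ' ≡ M ++ [ φ⁻¹e ]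
  Λ'≡M++φ⁻¹e = trans (orbitPairs-snoc φ e₁ e₂ 1 m)
    (cong (λ p → M ++ [ p ]) (cong₂ _,_ (iter-period φ e₁ (suc m) period₁) (iter-period φ e₂ (suc m) period₂)))
  φ-carries : Transports (φ ⟨$⟩ʳ_) (addRels R Λ) (addRels R Λ')
  φ-carries = subst (Transports (φ ⟨$⟩ʳ_) (addRels R Λ) ∘ addRels R)
    (sym (orbitPairs-shift φ e₁ e₂ 0 (suc m))) (addRels-transport {R = R} {R' = R} automorphism Λ)
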